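{- Let $G$ be a connected graph of diameter $2$ and let $e$ be an edge of $G$. Then ${\rm gp}(G)-1\le {\rm gp}(G-e)\le {\rm gp}(G)+1$. Moreover, both bounds are sharp: there exist such $G$ and $e$ with ${\rm gp}(G-e)={\rm gp}(G)-1$, and there exist such $G$ and $e$ with ${\rm gp}(G-e)={\rm gp}(G)+1$.
   Context: All graphs are simple. A set $X\subseteq V(G)$ is a general position set of $G$ if for every pair of distinct $u,v\in X$ and every shortest $u,v$-path $P$ in $G$ we have $V(P)\cap X=\{u,v\}$ (vertices in different components impose no condition). ${\rm gp}(G)$ is the maximum cardinality of a general position set of $G$. $G-e$ is the graph obtained from $G$ by deleting the edge $e$. -}

module Defs where

open import Data.Nat using (ℕ; zero; suc; _≤_)
open import Data.Fin using (Fin)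
open import Data.Fin.Subset using (Subset; _∈_; ∣_∣)
open import Data.List using (List; []; _∷_)
open import Data.List.Membership.Propositional renaming (_∈_ to _∈ₗ_)
open import Data.Product using (Σ; _×_; _,_; ∃; ∃-syntax)
open import Data.Sum using (_⊎_)
open import Relation.Binary.PropositionalEquality using (_≡_; _≢_)
open import Relation.Nullary using (¬_)

record Graph (n : ℕ) : Set₁ where
  field
    Adj    : Fin n → Fin n → Set
    sym    : ∀ {u v} → Adj u v → Adj v u
    irrefl : ∀ {u} → ¬ Adj u u
open Graph public

_─_,_ : ∀ {n} → Graph n → Fin n → Fin n → Graph n
G ─ a , b = record
  { Adj    = λ u v → Adj G u v × ¬ (u ≡ a × v ≡ b) × ¬ (u ≡ b × v ≡ a)
  ; sym    = λ { (e , p , q) →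
               Graph.sym G e , (λ { (x , y) → q (y , x) }) , (λ { (x , y) → p (y , x) }) }
  ; irrefl = λ { (e , _) → irrefl G e }
  }

data Walk {n} (G : Graph n) : Fin n → Fin n → Set where
  []  : ∀ {u} → Walk G u u
  _∷_ : ∀ {u w v} → Adj G u w → Walk G w v → Walk G u v

len : ∀ {n} {G : Graph n} {u v} → Walk G u v → ℕ
len []       = zero
len (_ ∷ p)  = suc (len p)

vertices : ∀ {n} {G : Graph n} {u v} → Walk G u v → List (Fin n)
vertices {u = u} []      = u ∷ []
vertices {u = u} (_ ∷ p) = u ∷ vertices p

-- A shortest u,v-path: a u,v-walk of minimum length (automatically a path).
IsShortest : ∀ {n} {G : Graph n} {u v} → Walk G u v → Set
IsShortest {G = G} {u} {v} p = ∀ (q : Walk G u v) → len p ≤ len q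

Dist : ∀ {n} → Graph n → Fin n → Fin n → ℕ → Set
Dist G u v d = Σ (Walk G u v) λ p → IsShortest p × len p ≡ d

Connected : ∀ {n} → Graph n → Set
Connected G = ∀ u v → Walk G u v

HasDiameter : ∀ {n} → Graph n → ℕ → Set
HasDiameter {n} G d =
  (∀ u v → ∃[ k ] (Dist G u v k × k ≤ d)) × (∃[ u ] ∃[ v ] Dist G u v d)

IsGPSet : ∀ {n} → Graph n → Subset n → Set
IsGPSet G X = ∀ {u v} → u ∈ X → v ∈ X → u ≢ v →
  (P : Walk G u v) → IsShortest P →
  ∀ {w} → w ∈ₗ vertices P → w ∈ X → w ≡ u ⊎ w ≡ v

IsGP : ∀ {n} → Graph n → ℕ → Set
IsGP G k = (∃[ X ] (IsGPSet G X × ∣ X ∣ ≡ k)) × (∀ X → IsGPSet G X → ∣ X ∣ ≤ k)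

module Submission where

-- A geodesic between two vertices at distance at most 2 has at most one interior vertex. So a set X
-- whose members are pairwise within distance 2 is in general position iff it contains no triple
-- u, w, v where w is a common neighbour of distinct, non-adjacent u and v ("w lies between u and v").
-- Deleting the edge ab changes betweenness only for triples through a. Hence removing a from a
-- general position set of G - ab leaves a general position set of G. Conversely, remove a from a
-- general position set X of G if a ∈ X, and b otherwise. Then a geodesic of G between two remaining
-- vertices can use ab only if its interior vertex is a ∈ X, which general position forbids. So
-- these geodesics survive in G - ab, and no new betweenness appears among the remaining vertices.
-- Sharpness: K₄ minus an edge has gp 3, and deleting the opposite edge gives C₄ with gp 2.
-- The path P₃ has gp 2, and deleting an edge gives K₂ + K₁ with gp 3.

open import Defs
open import Data.Nat using (ℕ; suc; _≤_; z≤n; s≤s; _≤?_)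
open import Data.Nat.Properties using (≤-refl; ≤-trans; ≤-reflexive; m≤n⇒m≤1+n)
open import Data.Fin using (Fin; zero; suc; _≟_)
open import Data.Fin.Patterns using (0F; 1F; 2F; 3F)
open import Data.Fin.Properties using (any?; all?)
open import Data.Fin.Subset using (Subset; _∈_; _∉_; _⊆_; ∣_∣; _-_; ⁅_⁆; ∁; _∪_; ⊤; inside; outside)
open import Data.Fin.Subset.Properties using (_∈?_; p─q⊆p; p─⊥≡p; anySubset?)
open import Data.Vec using (_∷_; here; there)
open import Data.List.Relation.Unary.Any using (here; there)
open import Data.List.Membership.Propositional using () renaming (_∈_ to _∈ₗ_)
open import Data.Product using (Σ-syntax; ∃-syntax; _×_; _,_; proj₁; proj₂)
open import Data.Sum using (_⊎_; inj₁; inj₂; [_,_]′)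
open import Data.Empty using (⊥-elim)
open import Function using (_∘_; id)
open import Relation.Binary.Definitions using (Decidable)
open import Relation.Binary.PropositionalEquality using (_≡_; _≢_; refl; cong; ≢-sym)
  renaming (sym to ≡-sym)
open import Relation.Nullary using (¬_; Dec; yes; no)
open import Relation.Nullary.Decidable
  using (True; toWitness; from-yes; map′; decidable-stable; ¬?; _×-dec_; _⊎-dec_; _→-dec_)

private variable
  n d k k′ : ℕ
  G : Graph n
  a b u v w : Fin n
  X Y : Subset n

x∉p-x : ∀ (p : Subset n) x → x ∉ p - x
x∉p-x (inside  ∷ p) zero    ()
x∉p-x (outside ∷ p) zero    ()
x∉p-x (inside  ∷ p) (suc x) (there x∈) = x∉p-x p x x∈
x∉p-x (outside ∷ p) (suc x) (there x∈) = x∉p-x p x x∈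

∣p∣≤suc∣p-x∣ : ∀ (p : Subset n) x → ∣ p ∣ ≤ suc ∣ p - x ∣
∣p∣≤suc∣p-x∣ (inside  ∷ p) zero    = s≤s (≤-reflexive (cong ∣_∣ (≡-sym (p─⊥≡p p))))
∣p∣≤suc∣p-x∣ (outside ∷ p) zero    = m≤n⇒m≤1+n (≤-reflexive (cong ∣_∣ (≡-sym (p─⊥≡p p))))
∣p∣≤suc∣p-x∣ (inside  ∷ p) (suc x) = s≤s (∣p∣≤suc∣p-x∣ p x)
∣p∣≤suc∣p-x∣ (outside ∷ p) (suc x) = ∣p∣≤suc∣p-x∣ p x

∉⇒≢ : a ∉ X → u ∈ X → u ≢ a
∉⇒≢ a∉X u∈X refl = a∉X u∈X

geodesic : HasDiameter G d → ∀ u v → Σ[ p ∈ Walk G u v ] (IsShortest p × len p ≤ d)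
geodesic (dist , _) u v with dist u v
... | _ , (p , p-shortest , refl) , p≤d = p , p-shortest , p≤d

connected : HasDiameter G d → Connected G
connected diam u v = proj₁ (geodesic diam u v)

shortest-distinct : (p : Walk G u v) → IsShortest p → 1 ≤ len p → u ≢ v
shortest-distinct p sh 1≤p refl with ≤-trans 1≤p (sh [])
... | ()

edge-shortest : (e : Adj G u v) → IsShortest {G = G} (e ∷ [])
edge-shortest {G = G} e []      = ⊥-elim (irrefl G e)
edge-shortest         _ (_ ∷ _) = s≤s z≤n

two-step-shortest : u ≢ v → ¬ Adj G u v → (e₁ : Adj G u w) (e₂ : Adj G w v) →
                    IsShortest {G = G} (e₁ ∷ e₂ ∷ [])
two-step-shortest u≢v _   _ _ []          = ⊥-elim (u≢v refl)
two-step-shortest _   ¬uv _ _ (e ∷ [])    = ⊥-elim (¬uv e)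
two-step-shortest _   _   _ _ (_ ∷ _ ∷ _) = s≤s (s≤s z≤n)

Between : Graph n → Fin n → Fin n → Fin n → Set
Between G u w v = Adj G u w × Adj G w v × u ≢ v × ¬ Adj G u v

BetweenTriple : Graph n → Subset n → Set
BetweenTriple G X = ∃[ u ] ∃[ w ] ∃[ v ] (u ∈ X × w ∈ X × v ∈ X × Between G u w v)

shortest⇒between : (e₁ : Adj G u w) (e₂ : Adj G w v) → IsShortest {G = G} (e₁ ∷ e₂ ∷ []) →
                   Between G u w v
shortest⇒between {G = G} {u} {v = v} e₁ e₂ sh =
  e₁ , e₂ , shortest-distinct (e₁ ∷ e₂ ∷ []) sh (s≤s z≤n) , ¬uv
  where
  ¬uv : ¬ Adj G u v
  ¬uv e with sh (e ∷ [])
  ... | s≤s ()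

between⇒dist2 : Between G u w v → Dist G u v 2
between⇒dist2 {G = G} (e₁ , e₂ , u≢v , ¬uv) =
  e₁ ∷ e₂ ∷ [] , two-step-shortest {G = G} u≢v ¬uv e₁ e₂ , refl

hasDiameter2 : (∀ u v → u ≡ v ⊎ Adj G u v ⊎ ∃[ w ] Between G u w v) →
               ∃[ u ] ∃[ w ] ∃[ v ] Between G u w v → HasDiameter G 2
hasDiameter2 {G = G} cover (u , _ , v , btw) = dist , u , v , between⇒dist2 btw
  where
  dist : ∀ u v → ∃[ k ] (Dist G u v k × k ≤ 2)
  dist u v with cover u v
  ... | inj₁ refl             = 0 , ([] , (λ _ → z≤n) , refl) , z≤n
  ... | inj₂ (inj₁ e)         = 1 , (e ∷ [] , edge-shortest {G = G} e , refl) , s≤s z≤n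
  ... | inj₂ (inj₂ (_ , btw)) = 2 , between⇒dist2 btw , ≤-refl

geodesic₂-vertex : ∀ {G : Graph n} (P : Walk G u v) → IsShortest P → len P ≤ 2 →
                   w ∈ₗ vertices P → w ≡ u ⊎ w ≡ v ⊎ Between G u w v
geodesic₂-vertex []              _  _              (here refl)                 = inj₁ refl
geodesic₂-vertex []              _  _              (there ())
geodesic₂-vertex (_ ∷ [])        _  _              (here refl)                 = inj₁ refl
geodesic₂-vertex (_ ∷ [])        _  _              (there (here refl))         = inj₂ (inj₁ refl)
geodesic₂-vertex (_ ∷ [])        _  _              (there (there ()))
geodesic₂-vertex (_ ∷ _ ∷ [])    _  _              (here refl)                 = inj₁ refl
geodesic₂-vertex {G = G} (e₁ ∷ e₂ ∷ []) sh _       (there (here refl))         =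
  inj₂ (inj₂ (shortest⇒between {G = G} e₁ e₂ sh))
geodesic₂-vertex (_ ∷ _ ∷ [])    _  _              (there (there (here refl))) = inj₂ (inj₁ refl)
geodesic₂-vertex (_ ∷ _ ∷ [])    _  _              (there (there (there ())))
geodesic₂-vertex (_ ∷ _ ∷ _ ∷ _) _  (s≤s (s≤s ())) _

gp⇒¬between : IsGPSet G X → ¬ BetweenTriple G X
gp⇒¬between {G = G} gp (_ , _ , _ , u∈X , w∈X , v∈X , e₁ , e₂ , u≢v , ¬uv)
  with gp u∈X v∈X u≢v (e₁ ∷ e₂ ∷ []) (two-step-shortest {G = G} u≢v ¬uv e₁ e₂) (there (here refl)) w∈X
... | inj₁ refl = irrefl G e₁
... | inj₂ refl = irrefl G e₂

gp-bound : (∀ Y → ∣ Y ∣ ≤ k ⊎ BetweenTriple G Y) → ∀ Y → IsGPSet G Y → ∣ Y ∣ ≤ k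
gp-bound small-or-between Y gp = [ id , ⊥-elim ∘ gp⇒¬between gp ]′ (small-or-between Y)

WithinDistance2 : Graph n → Subset n → Set
WithinDistance2 G X = ∀ {u v} → u ∈ X → v ∈ X → Σ[ p ∈ Walk G u v ] len p ≤ 2

¬between⇒gp : WithinDistance2 G X → ¬ BetweenTriple G X → IsGPSet G X
¬between⇒gp near free u∈X v∈X _ P P-shortest w∈P w∈X with near u∈X v∈X
... | p , p≤2 with geodesic₂-vertex P P-shortest (≤-trans (P-shortest p) p≤2) w∈P
...   | inj₁ w≡u        = inj₁ w≡u
...   | inj₂ (inj₁ w≡v) = inj₂ w≡v
...   | inj₂ (inj₂ btw) = ⊥-elim (free (_ , _ , _ , u∈X , w∈X , v∈X , btw))

Isolated : Graph n → Fin n → Set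
Isolated G u = ∀ v → ¬ Adj G u v

walk-from-isolated : Isolated G u → Walk G u v → u ≡ v
walk-from-isolated _   []      = refl
walk-from-isolated iso (e ∷ _) = ⊥-elim (iso _ e)

walk-to-isolated : Isolated G v → Walk G u v → u ≡ v
walk-to-isolated         _   []      = refl
walk-to-isolated {G = G} iso (e ∷ p) with walk-to-isolated iso p
... | refl = ⊥-elim (iso _ (Graph.sym G e))

adjacent-or-isolated⇒gp :
  (∀ u v → u ∈ X → v ∈ X → u ≢ v → Adj G u v ⊎ Isolated G u ⊎ Isolated G v) → IsGPSet G X
adjacent-or-isolated⇒gp h {u} {v} u∈X v∈X u≢v P P-shortest w∈P _ with h u v u∈X v∈X u≢v
... | inj₂ (inj₁ u-isolated) = ⊥-elim (u≢v (walk-from-isolated u-isolated P))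
... | inj₂ (inj₂ v-isolated) = ⊥-elim (u≢v (walk-to-isolated v-isolated P))
... | inj₁ e with geodesic₂-vertex P P-shortest (≤-trans (P-shortest (e ∷ [])) (s≤s z≤n)) w∈P
...   | inj₁ w≡u                      = inj₁ w≡u
...   | inj₂ (inj₁ w≡v)               = inj₂ w≡v
...   | inj₂ (inj₂ (_ , _ , _ , ¬uv)) = ⊥-elim (¬uv e)

─-adj : Adj G u v → u ≢ a → v ≢ a → Adj (G ─ a , b) u v
─-adj e u≢a v≢a = e , u≢a ∘ proj₁ , v≢a ∘ proj₂

between-─⁺ : Between G u w v → u ≢ a → w ≢ a → v ≢ a → Between (G ─ a , b) u w v
between-─⁺ {G = G} (e₁ , e₂ , u≢v , ¬uv) u≢a w≢a v≢a =
  ─-adj {G = G} e₁ u≢a w≢a , ─-adj {G = G} e₂ w≢a v≢a , u≢v , ¬uv ∘ proj₁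

between-─⁻ : Between (G ─ a , b) u w v → u ≢ a → v ≢ a → Between G u w v
between-─⁻ {G = G} (e₁ , e₂ , u≢v , ¬uv) u≢a v≢a =
  proj₁ e₁ , proj₁ e₂ , u≢v , λ e → ¬uv (─-adj {G = G} e u≢a v≢a)

gp-restore-edge : HasDiameter G 2 → IsGPSet (G ─ a , b) Y → IsGPSet G (Y - a)
gp-restore-edge {G = G} {a = a} {Y = Y} diam gp = ¬between⇒gp near free
  where
  near : WithinDistance2 G (Y - a)
  near {u} {v} _ _ = let p , _ , p≤2 = geodesic diam u v in p , p≤2
  ≢a : u ∈ Y - a → u ≢ a
  ≢a = ∉⇒≢ (x∉p-x Y a)
  free : ¬ BetweenTriple G (Y - a)
  free (u , w , v , u∈ , w∈ , v∈ , btw) =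
    gp⇒¬between gp (u , w , v , p─q⊆p Y ⁅ a ⁆ u∈ , p─q⊆p Y ⁅ a ⁆ w∈ , p─q⊆p Y ⁅ a ⁆ v∈ ,
                    between-─⁺ {G = G} btw (≢a u∈) (≢a w∈) (≢a v∈))

gp-delete-edge : HasDiameter G 2 → IsGPSet G X → Y ⊆ X → a ∉ Y → (b ∈ Y → a ∈ X) →
                 IsGPSet (G ─ a , b) Y
gp-delete-edge {G = G} {X = X} {Y = Y} {a = a} {b = b} diam gp Y⊆X a∉Y b∈Y⇒a∈X = ¬between⇒gp near free
  where
  free : ¬ BetweenTriple (G ─ a , b) Y
  free (u , w , v , u∈ , w∈ , v∈ , btw) =
    gp⇒¬between gp (u , w , v , Y⊆X u∈ , Y⊆X w∈ , Y⊆X v∈ ,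
                    between-─⁻ {G = G} btw (∉⇒≢ a∉Y u∈) (∉⇒≢ a∉Y v∈))
  lift : (p : Walk G u v) → IsShortest p → len p ≤ 2 → u ∈ Y → v ∈ Y →
         Σ[ q ∈ Walk (G ─ a , b) u v ] len q ≤ 2
  lift []              _  _              _  _  = [] , z≤n
  lift (e ∷ [])        _  _              u∈ v∈ = ─-adj {G = G} e (∉⇒≢ a∉Y u∈) (∉⇒≢ a∉Y v∈) ∷ [] , s≤s z≤n
  lift (e₁ ∷ e₂ ∷ [])  sh _              u∈ v∈ =
    (e₁ , ∉⇒≢ a∉Y u∈ ∘ proj₁ , λ (u≡b , w≡a) → middle≢a u∈ u≡b w≡a) ∷
    (e₂ , (λ (w≡a , v≡b) → middle≢a v∈ v≡b w≡a) , ∉⇒≢ a∉Y v∈ ∘ proj₂) ∷ [] , ≤-refl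
    where
    middle∉X : _ ∉ X
    middle∉X w∈ = gp⇒¬between gp (_ , _ , _ , Y⊆X u∈ , w∈ , Y⊆X v∈ , shortest⇒between {G = G} e₁ e₂ sh)
    middle≢a : ∀ {x} → x ∈ Y → x ≡ b → _ ≢ a
    middle≢a x∈ refl refl = middle∉X (b∈Y⇒a∈X x∈)
  lift (_ ∷ _ ∷ _ ∷ _) _  (s≤s (s≤s ())) _  _
  near : WithinDistance2 (G ─ a , b) Y
  near {u} {v} u∈ v∈ = let p , p-shortest , p≤2 = geodesic diam u v in lift p p-shortest p≤2 u∈ v∈

delete-edge-shrink : HasDiameter G 2 → IsGPSet G X →
                     ∃[ Y ] (IsGPSet (G ─ a , b) Y × ∣ X ∣ ≤ suc ∣ Y ∣)
delete-edge-shrink {X = X} {a = a} {b = b} diam gp with a ∈? X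
... | yes a∈X = X - a , gp-delete-edge diam gp (p─q⊆p X ⁅ a ⁆) (x∉p-x X a) (λ _ → a∈X)
                      , ∣p∣≤suc∣p-x∣ X a
... | no  a∉X = X - b , gp-delete-edge diam gp (p─q⊆p X ⁅ b ⁆) (a∉X ∘ p─q⊆p X ⁅ b ⁆) (⊥-elim ∘ x∉p-x X b)
                      , ∣p∣≤suc∣p-x∣ X b

restore-edge-shrink : HasDiameter G 2 → IsGPSet (G ─ a , b) Y →
                      ∃[ X ] (IsGPSet G X × ∣ Y ∣ ≤ suc ∣ X ∣)
restore-edge-shrink {a = a} {Y = Y} diam gp = Y - a , gp-restore-edge diam gp , ∣p∣≤suc∣p-x∣ Y a

gp≤suc : ∀ {H : Graph n} → IsGP G k → IsGP H k′ →
         (∀ {X} → IsGPSet G X → ∃[ Y ] (IsGPSet H Y × ∣ X ∣ ≤ suc ∣ Y ∣)) → k ≤ suc k′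
gp≤suc ((X , X-gp , refl) , _) (_ , H-max) shrink =
  let Y , Y-gp , X≤Y = shrink X-gp in ≤-trans X≤Y (s≤s (H-max Y Y-gp))

allSubset? : {P : Subset n → Set} → (∀ X → Dec (P X)) → Dec (∀ X → P X)
allSubset? P? = map′ (λ no-counterexample X → decidable-stable (P? X) (no-counterexample ∘ (X ,_)))
                     (λ all (X , ¬PX) → ¬PX (all X))
                     (¬? (anySubset? (¬? ∘ P?)))

complete : (n : ℕ) → Graph n
complete n = record { Adj = _≢_ ; sym = ≢-sym ; irrefl = λ u≢u → u≢u refl }

complete-adj? : Decidable (Adj (complete n))
complete-adj? u v = ¬? (u ≟ v)

─-adj? : Decidable (Adj G) → Decidable (Adj (G ─ a , b))
─-adj? {a = a} {b = b} adj? u v = adj? u v ×-dec ¬? (u ≟ a ×-dec v ≟ b) ×-dec ¬? (u ≟ b ×-dec v ≟ a)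

module Decision {G : Graph n} (adj? : Decidable (Adj G)) where

  between? : ∀ u w v → Dec (Between G u w v)
  between? u w v = adj? u w ×-dec adj? w v ×-dec ¬? (u ≟ v) ×-dec ¬? (adj? u v)

  betweenTriple? : ∀ X → Dec (BetweenTriple G X)
  betweenTriple? X = any? λ u → any? λ w → any? λ v →
    u ∈? X ×-dec w ∈? X ×-dec v ∈? X ×-dec between? u w v

  isolated? : ∀ u → Dec (Isolated G u)
  isolated? u = all? λ v → ¬? (adj? u v)

  hasDiameter2-by-decision :
    {True (all? λ u → all? λ v → u ≟ v ⊎-dec adj? u v ⊎-dec any? λ w → between? u w v)} →
    {True (any? λ u → any? λ w → any? λ v → between? u w v)} →
    HasDiameter G 2
  hasDiameter2-by-decision {cover} {far} = hasDiameter2 (toWitness cover) (toWitness far)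

  gp-by-decision : (X : Subset n) →
    {True (all? λ u → all? λ v →
             u ∈? X →-dec v ∈? X →-dec ¬? (u ≟ v) →-dec (adj? u v ⊎-dec isolated? u ⊎-dec isolated? v))} →
    {True (allSubset? λ Y → ∣ Y ∣ ≤? ∣ X ∣ ⊎-dec betweenTriple? Y)} →
    IsGP G ∣ X ∣
  gp-by-decision X {adjacent-or-isolated} {bound} =
    (X , adjacent-or-isolated⇒gp (toWitness adjacent-or-isolated) , refl) , gp-bound (toWitness bound)

diamond : Graph 4
diamond = complete 4 ─ 2F , 3F

diamond-adj? : Decidable (Adj diamond)
diamond-adj? = ─-adj? {G = complete 4} complete-adj?

diamond-diameter : HasDiameter diamond 2
diamond-diameter = Decision.hasDiameter2-by-decision diamond-adj?

diamond-gp : IsGP diamond 3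
diamond-gp = Decision.gp-by-decision diamond-adj? (∁ ⁅ 3F ⁆)

-- the 4-cycle 0 – 2 – 1 – 3 – 0
square-gp : IsGP (diamond ─ 0F , 1F) 2
square-gp = Decision.gp-by-decision (─-adj? {G = diamond} diamond-adj?) (⁅ 0F ⁆ ∪ ⁅ 2F ⁆)

path₃ : Graph 3
path₃ = complete 3 ─ 0F , 2F

path₃-adj? : Decidable (Adj path₃)
path₃-adj? = ─-adj? {G = complete 3} complete-adj?

path₃-diameter : HasDiameter path₃ 2
path₃-diameter = Decision.hasDiameter2-by-decision path₃-adj?

path₃-gp : IsGP path₃ 2
path₃-gp = Decision.gp-by-decision path₃-adj? (∁ ⁅ 2F ⁆)

-- the edge 1 – 2 together with the isolated vertex 0
path₃-split-gp : IsGP (path₃ ─ 0F , 1F) 3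
path₃-split-gp = Decision.gp-by-decision (─-adj? {G = path₃} path₃-adj?) ⊤

theorem6p3 :
    ((n : ℕ) (G : Graph n) (a b : Fin n) → Connected G → HasDiameter G 2 → Adj G a b →
      (k k′ : ℕ) → IsGP G k → IsGP (G ─ a , b) k′ →
      (k ≤ suc k′) × (k′ ≤ suc k))
    × (∃[ n ] ∃[ G ] ∃[ a ] ∃[ b ] ∃[ k ] ∃[ k′ ]
        (Connected {n} G × HasDiameter G 2 × Adj G a b × IsGP G k × IsGP (G ─ a , b) k′
          × suc k′ ≡ k))
    × (∃[ n ] ∃[ G ] ∃[ a ] ∃[ b ] ∃[ k ] ∃[ k′ ]
        (Connected {n} G × HasDiameter G 2 × Adj G a b × IsGP G k × IsGP (G ─ a , b) k′
          × k′ ≡ suc k))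
theorem6p3 =
  (λ _ _ _ _ _ diam _ _ _ gp gp′ →
     gp≤suc gp gp′ (delete-edge-shrink diam) , gp≤suc gp′ gp (restore-edge-shrink diam))
  , (4 , diamond , 0F , 1F , 3 , 2 , connected diamond-diameter , diamond-diameter ,
     from-yes (diamond-adj? 0F 1F) , diamond-gp , square-gp , refl)
  , (3 , path₃ , 0F , 1F , 2 , 3 , connected path₃-diameter , path₃-diameter ,
     from-yes (path₃-adj? 0F 1F) , path₃-gp , path₃-split-gp , refl)
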